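{- For every $n\ge1$, the periodic points of the map $s_{\{123,132\}}:S_n\to S_n$ are exactly the half-decreasing permutations of length $n$.
   Context: A point $a$ is periodic for $f:A\to A$ if $f^k(a)=a$ for some integer $k>0$. A permutation $\pi$ of length $n$ is half-decreasing if the subsequence $\pi(n-1)\pi(n-3)\cdots\pi(2)$ (for odd $n$), respectively $\pi(n-1)\pi(n-3)\cdots\pi(3)$ (for even $n$), is literally equal to $1\,2\cdots\lfloor\frac{n-1}{2}\rfloor$ (i.e. $\pi(n-1)=1$, $\pi(n-3)=2$, etc.). A sequence of distinct integers contains a permutation $\tau$ if some subsequence is order-isomorphic to $\tau$; otherwise it avoids $\tau$. For a set $T$ of permutations, the map $s_T$ is defined by: read the input permutation left to right with an initially empty stack and output; at each step, if there is a next input element and pushing it keeps the stack contents, read from top to bottom, $T$-avoiding, push it; otherwise pop the top of the stack and append it to the output; stop when input and stack are empty; the output is $s_T(\pi)$. -}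

module Defs where

open import Data.Nat using (ℕ; zero; suc; _+_; _*_; _∸_; _<_; _≤_; _/_)
open import Data.List using (List; []; _∷_; zip; upTo; map)
open import Data.List.Relation.Unary.All using (All)
open import Data.List.Relation.Binary.Sublist.Propositional using (_⊆_)
open import Data.List.Relation.Binary.Permutation.Propositional using (_↭_)
open import Data.Maybe using (Maybe; just; nothing)
open import Data.Product using (_×_; Σ; ∃; _,_)
open import Data.Unit using (⊤)
open import Data.Empty using (⊥)
open import Relation.Nullary using (¬_)
open import Relation.Binary.PropositionalEquality using (_≡_)
open import Relation.Binary.Construct.Closure.Transitive using (TransClosure)
open import Function.Bundles using (_⇔_)

IsPerm : ℕ → List ℕ → Set
IsPerm n π = π ↭ map suc (upTo n)

OrdIso : List ℕ → List ℕ → Set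
OrdIso [] [] = ⊤
OrdIso [] (_ ∷ _) = ⊥
OrdIso (_ ∷ _) [] = ⊥
OrdIso (x ∷ xs) (y ∷ ys) =
  All (λ { (a , b) → ((x < a) ⇔ (y < b)) × ((a < x) ⇔ (b < y)) }) (zip xs ys)
  × OrdIso xs ys

Contains : List ℕ → List ℕ → Set
Contains σ τ = Σ (List ℕ) λ sub → (sub ⊆ σ) × OrdIso sub τ

Avoids : List ℕ → List ℕ → Set
Avoids σ τ = ¬ Contains σ τ

AvoidsAll : List (List ℕ) → List ℕ → Set
AvoidsAll T σ = All (Avoids σ) T

-- Pushing is not allowed: no next input, or pushing it would create a pattern
-- from T in the stack (read from top to bottom; the list head is the top).
NoPush : List (List ℕ) → List ℕ → List ℕ → Set
NoPush T [] st = ⊤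
NoPush T (x ∷ _) st = ¬ AvoidsAll T (x ∷ st)

-- Run T input stack out : starting from this input and stack, the algorithm
-- outputs `out` (the remaining output) and terminates.
data Run (T : List (List ℕ)) : List ℕ → List ℕ → List ℕ → Set where
  done : Run T [] [] []
  push : ∀ {x inp st out} → AvoidsAll T (x ∷ st) →
         Run T inp (x ∷ st) out → Run T (x ∷ inp) st out
  pop  : ∀ {y inp st out} → NoPush T inp (y ∷ st) →
         Run T inp st out → Run T inp (y ∷ st) (y ∷ out)

sMap : List (List ℕ) → List ℕ → List ℕ → Set
sMap T π σ = Run T π [] σ

T123-132 : List (List ℕ)
T123-132 = (1 ∷ 2 ∷ 3 ∷ []) ∷ (1 ∷ 3 ∷ 2 ∷ []) ∷ []

Periodic : List (List ℕ) → List ℕ → Set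
Periodic T π = TransClosure (sMap T) π π

-- 1-indexed access.
at : List ℕ → ℕ → Maybe ℕ
at [] _ = nothing
at (x ∷ xs) zero = nothing
at (x ∷ xs) (suc zero) = just x
at (x ∷ xs) (suc (suc k)) = at xs (suc k)

HalfDecreasing : ℕ → List ℕ → Set
HalfDecreasing n π = ∀ i → 1 ≤ i → i ≤ (n ∸ 1) / 2 → at π (suc n ∸ (2 * i)) ≡ just i

-- Pushing x onto a stack of distinct entries that avoids 123 and 132 keeps it so exactly when
-- at most one entry exceeds x. Say ρ has level j if it ends in a ladder j z₁ (j−1) z₂ … 1 zⱼ;
-- then all other entries exceed j. For ρ = a w ladder(z₁ … zⱼ), the letter a stays at the
-- bottom of the stack while w is read, and the ladder comes out as z₁ followed by the ladder
-- of z₂ … zⱼ a. Hence s preserves level j while 2j < n, each pass moves the label j + 1 one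
-- place towards the prefix, and once j + 1 is in the prefix the next pass reaches level j + 1.
-- So a periodic permutation has the top level m = ⌊(n−1)/2⌋, which is the half-decreasing
-- condition. Conversely, at level m the prefix has at most two letters and s merely rotates
-- the word a w z₁ … zₘ, so the permutation returns to itself.
module Submission where

open import Defs
open import Data.Empty using (⊥-elim)
open import Data.Maybe using (just)
open import Data.Maybe.Properties using (just-injective)
open import Data.Nat
  using (ℕ; zero; suc; _+_; _*_; _∸_; _/_; _%_; _<_; _≤_; _<?_; _≤?_; _≟_; z≤n; s≤s; z<s; s<s)
open import Data.Nat.Properties
  using ( suc-injective; ≤-refl; ≤-trans; <-trans; <-asym; <-irrefl; <-cmp; ≤-<-connex; ≰⇒>; <⇒≱
        ; ≤∧≢⇒<; <⇒≤; 1+n≰n; 0≢1+n; n<1+n; ≤-pred; m≤n⇒m≤1+n; m≤m+n; m≤n+m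
        ; +-comm; +-suc; +-identityʳ; +-mono-<; +-cancelˡ-≡; +-cancelʳ-<
        ; *-comm; *-suc; n∸n≡0; +-∸-assoc; m+n∸n≡m; m+[n∸m]≡n)
open import Data.Nat.DivMod using (m≡m%n+[m/n]*n; m%n<n)
open import Data.Nat.Tactic.RingSolver using (solve-∀)
open import Data.List using (List; []; _∷_; [_]; _++_; length; filter; map; upTo; downFrom)
open import Data.List.Properties
  using ( length-++; length-map; length-upTo; ++-assoc; ++-identityʳ; ∷ʳ-injectiveˡ
        ; length-filter; filter-all; filter-reject)
open import Data.List.Membership.Propositional using (_∈_)
open import Data.List.Membership.Propositional.Properties
  using (∈-map⁺; ∈-map⁻; ∈-upTo⁺; ∈-downFrom⁺; ∈-downFrom⁻; ∈-++⁺ˡ; ∈-++⁺ʳ; ∈-++⁻; ∈-∃++)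
open import Data.List.Relation.Unary.Any using (here; there)
open import Data.List.Relation.Unary.All as All using (All; []; _∷_)
open import Data.List.Relation.Unary.All.Properties using (all-filter; ++⁻; ++⁻ˡ; ++⁻ʳ)
open import Data.List.Relation.Unary.Unique.Propositional using (Unique; []; _∷_)
import Data.List.Relation.Unary.AllPairs as AllPairs
import Data.List.Relation.Unary.Unique.Propositional.Properties as Unique
open import Data.List.Relation.Binary.Disjoint.Propositional using (Disjoint)
open import Data.List.Relation.Binary.Sublist.Propositional using (_⊆_; []; _∷_; _∷ʳ_; ⊆-refl; ⊆-trans; minimum)
open import Data.List.Relation.Binary.Sublist.Propositional.Properties using (filter-⊆; filter⁺; length-mono-≤)
open import Data.List.Relation.Binary.Permutation.Propositional
  using (_↭_; refl; prep; swap; ↭-sym; ↭-trans; ↭-reflexive; ↭⇒↭ₛ)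
open import Data.List.Relation.Binary.Permutation.Propositional.Properties
  using (All-resp-↭; ∈-resp-↭; ↭-length; shift; ++⁺ˡ)
import Data.List.Relation.Binary.Permutation.Setoid.Properties as PermutationSetoid
open import Data.Product using (_×_; _,_; proj₁; proj₂; ∃; ∃₂)
open import Data.Sum using (_⊎_; inj₁; inj₂)
open import Data.Unit using (tt)
open import Function using (_∘_; const; id)
open import Function.Bundles using (_⇔_; mk⇔; Equivalence)
open import Relation.Binary.Construct.Closure.Transitive using (TransClosure; _∷_) renaming ([_] to [_]⁺)
open import Relation.Binary.Definitions using (tri<; tri≈; tri>)
open import Relation.Binary.PropositionalEquality
  using (_≡_; _≢_; refl; sym; trans; cong; cong₂; subst; subst₂; setoid; module ≡-Reasoning)
open import Relation.Nullary using (¬_; yes; no; contradiction)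

open ≡-Reasoning

_^_ : {A : Set} → (A → A) → ℕ → A → A
(f ^ zero)  x = x
(f ^ suc k) x = (f ^ k) (f x)

^-+ : ∀ {A : Set} (f : A → A) m k x → (f ^ (m + k)) x ≡ (f ^ k) ((f ^ m) x)
^-+ f zero    k x = refl
^-+ f (suc m) k x = ^-+ f m k (f x)

^-*-periodic : ∀ {A : Set} (f : A → A) {x} p → (f ^ suc p) x ≡ x → ∀ K → (f ^ (K * suc p)) x ≡ x
^-*-periodic f     p period zero    = refl
^-*-periodic f {x} p period (suc K) = begin
  (f ^ (suc p + K * suc p)) x       ≡⟨ ^-+ f (suc p) (K * suc p) x ⟩
  (f ^ (K * suc p)) ((f ^ suc p) x) ≡⟨ cong (f ^ (K * suc p)) period ⟩
  (f ^ (K * suc p)) x               ≡⟨ ^-*-periodic f p period K ⟩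
  x                                 ∎

length-∷ʳ : ∀ (xs : List ℕ) x → length (xs ++ [ x ]) ≡ suc (length xs)
length-∷ʳ xs x = trans (length-++ xs) (+-comm (length xs) 1)

Unique-resp-↭ : {xs ys : List ℕ} → xs ↭ ys → Unique xs → Unique ys
Unique-resp-↭ p = PermutationSetoid.Unique-resp-↭ (setoid ℕ) (↭⇒↭ₛ p)

Unique-++⁻ : ∀ (xs : List ℕ) {ys} → Unique (xs ++ ys) → Unique xs × Unique ys × Disjoint xs ys
Unique-++⁻ []       u          = [] , u , λ ()
Unique-++⁻ (x ∷ xs) (x∉ ∷ u) with Unique-++⁻ xs u
... | u-xs , u-ys , xs#ys = ++⁻ˡ xs x∉ ∷ u-xs , u-ys , λ where
  (here refl , v∈ys)  → All.lookup (++⁻ʳ xs x∉) v∈ys refl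
  (there v∈xs , v∈ys) → xs#ys (v∈xs , v∈ys)

split-at : ∀ k (xs : List ℕ) → k ≤ length xs → ∃₂ λ P L → xs ≡ P ++ L × length P ≡ k
split-at zero    xs       _         = [] , xs , refl , refl
split-at (suc k) (x ∷ xs) (s≤s k≤) with split-at k xs k≤
... | P , L , refl , refl = x ∷ P , L , refl , refl

-- Avoiding 123 and 132

Avoids-[] : ∀ t τ → Avoids [] (t ∷ τ)
Avoids-[] t τ ([] , [] , ())

AvoidsAll-⊆ : ∀ {T σ σ′} → σ ⊆ σ′ → AvoidsAll T σ′ → AvoidsAll T σ
AvoidsAll-⊆ σ⊆σ′ = All.map λ avoids (sub , sub⊆σ , iso) → avoids (sub , ⊆-trans sub⊆σ σ⊆σ′ , iso)

countAbove : ℕ → List ℕ → ℕ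
countAbove x st = length (filter (x <?_) st)

countAbove-all : ∀ {x st} → All (x <_) st → countAbove x st ≡ length st
countAbove-all {x} x<st = cong length (filter-all (x <?_) x<st)

countAbove-⊆ : ∀ {x sub st} → sub ⊆ st → All (x <_) sub → length sub ≤ countAbove x st
countAbove-⊆ {x} sub⊆st x<sub =
  subst (_≤ _) (countAbove-all x<sub) (length-mono-≤ (filter⁺ (x <?_) (x <?_) (λ { refl → id }) sub⊆st))

countAbove-pair : ∀ {x y a} → ¬ x < y → countAbove x (y ∷ [ a ]) ≤ 1
countAbove-pair {x} {a = a} x≮y =
  subst (_≤ 1) (sym (cong length (filter-reject (x <?_) x≮y))) (length-filter (x <?_) [ a ])

two-above : ∀ {x st} → Unique st → 2 ≤ countAbove x st →
            ∃₂ λ b c → b ∷ c ∷ [] ⊆ st × x < b × x < c × b ≢ c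
two-above {x} {st} u two≤
  with filter (x <?_) st | filter-⊆ (x <?_) st | all-filter (x <?_) st | Unique.filter⁺ (x <?_) u
... | b ∷ c ∷ _ | bc⊆st | x<b ∷ x<c ∷ _ | (b≢c ∷ _) ∷ _ =
  b , c , ⊆-trans (refl ∷ refl ∷ minimum _) bc⊆st , x<b , x<c , b≢c
two-above u (s≤s ()) | _ ∷ [] | _ | _ | _

agree< : ∀ {x a y b} → x < a → y < b → ((x < a) ⇔ (y < b)) × ((a < x) ⇔ (b < y))
agree< x<a y<b = mk⇔ (const y<b) (const x<a) , mk⇔ (⊥-elim ∘ <-asym x<a) (⊥-elim ∘ <-asym y<b)

agree> : ∀ {x a y b} → a < x → b < y → ((x < a) ⇔ (y < b)) × ((a < x) ⇔ (b < y))
agree> a<x b<y = mk⇔ (⊥-elim ∘ <-asym a<x) (⊥-elim ∘ <-asym b<y) , mk⇔ (const b<y) (const a<x)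

pattern-123-or-132 : ∀ {x b c} → x < b → x < c → b ≢ c →
             OrdIso (x ∷ b ∷ c ∷ []) (1 ∷ 2 ∷ 3 ∷ []) ⊎ OrdIso (x ∷ b ∷ c ∷ []) (1 ∷ 3 ∷ 2 ∷ [])
pattern-123-or-132 {b = b} {c} x<b x<c b≢c with <-cmp b c
... | tri< b<c _ _ =
  inj₁ ((agree< x<b (s<s z<s) ∷ agree< x<c (s<s z<s) ∷ []) , (agree< b<c (s<s (s<s z<s)) ∷ []) , [] , tt)
... | tri≈ _ b≡c _ = contradiction b≡c b≢c
... | tri> _ _ c<b =
  inj₂ ((agree< x<b (s<s z<s) ∷ agree< x<c (s<s z<s) ∷ []) , (agree> c<b (s<s (s<s z<s)) ∷ []) , [] , tt)

push-forbidden : ∀ {x st} → Unique st → 2 ≤ countAbove x st → ¬ AvoidsAll T123-132 (x ∷ st)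
push-forbidden u two≤ (avoids-123 ∷ avoids-132 ∷ []) with two-above u two≤
... | _ , _ , bc⊆st , x<b , x<c , b≢c with pattern-123-or-132 x<b x<c b≢c
...   | inj₁ iso = avoids-123 (_ , refl ∷ bc⊆st , iso)
...   | inj₂ iso = avoids-132 (_ , refl ∷ bc⊆st , iso)

-- An occurrence of 1pq that uses x must use it as the 1, so it needs two entries above x.
push-avoids : ∀ {x st p q} → 1 < p → 1 < q → Avoids st (1 ∷ p ∷ q ∷ []) → countAbove x st ≤ 1 →
              Avoids (x ∷ st) (1 ∷ p ∷ q ∷ [])
push-avoids _ _ avoids _ (_ , _ ∷ʳ sub⊆st , iso) = avoids (_ , sub⊆st , iso)
push-avoids 1<p 1<q _ count≤1 (_ ∷ _ ∷ _ ∷ [] , refl ∷ bc⊆st , ((x<b⇔ , _) ∷ (x<c⇔ , _) ∷ []) , _) =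
  1+n≰n (≤-trans (countAbove-⊆ bc⊆st (Equivalence.from x<b⇔ 1<p ∷ Equivalence.from x<c⇔ 1<q ∷ [])) count≤1)
push-avoids _ _ _ _ (_ ∷ [] , refl ∷ _ , _ , ())
push-avoids _ _ _ _ (_ ∷ _ ∷ [] , refl ∷ _ , _ , _ , ())
push-avoids _ _ _ _ (_ ∷ _ ∷ _ ∷ _ ∷ _ , refl ∷ _ , _ , _ , _ , ())

push-allowed : ∀ {x st} → AvoidsAll T123-132 st → countAbove x st ≤ 1 → AvoidsAll T123-132 (x ∷ st)
push-allowed (avoids-123 ∷ avoids-132 ∷ []) count≤1 =
    push-avoids (s<s z<s) (s<s z<s) avoids-123 count≤1
  ∷ push-avoids (s<s z<s) (s<s z<s) avoids-132 count≤1
  ∷ []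

-- The stack map s

Run-deterministic : ∀ {T inp st o₁ o₂} → Run T inp st o₁ → Run T inp st o₂ → o₁ ≡ o₂
Run-deterministic done              done              = refl
Run-deterministic (push _ r₁)       (push _ r₂)       = Run-deterministic r₁ r₂
Run-deterministic (push allowed _)  (pop blocked _)   = contradiction allowed blocked
Run-deterministic (pop blocked _)   (push allowed _)  = contradiction allowed blocked
Run-deterministic (pop _ r₁)        (pop _ r₂)        = cong (_ ∷_) (Run-deterministic r₁ r₂)

Run-flush : ∀ {T} st → Run T [] st st
Run-flush []       = done
Run-flush (y ∷ st) = pop tt (Run-flush st)

-- The push test of Run T123-132, by push-allowed and push-forbidden.
run     : List ℕ → List ℕ → List ℕ
run-∷ : ℕ → List ℕ → List ℕ → List ℕ
run []        st = st
run (x ∷ inp) st = run-∷ x inp st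
run-∷ x inp []       = run inp [ x ]
run-∷ x inp (y ∷ st) with countAbove x (y ∷ st) ≤? 1
... | yes _ = run inp (x ∷ y ∷ st)
... | no  _ = y ∷ run-∷ x inp st

sT : List ℕ → List ℕ
sT π = run π []

run-push : ∀ {x inp} st → countAbove x st ≤ 1 → run (x ∷ inp) st ≡ run inp (x ∷ st)
run-push     []       _       = refl
run-push {x} (y ∷ st) count≤1 with countAbove x (y ∷ st) ≤? 1
... | yes _       = refl
... | no  count≰1 = contradiction count≤1 count≰1

run-pop : ∀ {x inp y st} → 1 < countAbove x (y ∷ st) → run (x ∷ inp) (y ∷ st) ≡ y ∷ run (x ∷ inp) st
run-pop {x} {y = y} {st} 1<count with countAbove x (y ∷ st) ≤? 1
... | yes count≤1 = contradiction count≤1 (<⇒≱ 1<count)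
... | no  _       = refl

run-↭   : ∀ inp st → run inp st ↭ st ++ inp
run-∷-↭ : ∀ x inp st → run-∷ x inp st ↭ st ++ x ∷ inp
run-↭ []        st = ↭-reflexive (sym (++-identityʳ st))
run-↭ (x ∷ inp) st = run-∷-↭ x inp st
run-∷-↭ x inp []       = run-↭ inp [ x ]
run-∷-↭ x inp (y ∷ st) with countAbove x (y ∷ st) ≤? 1
... | yes _ = ↭-trans (run-↭ inp (x ∷ y ∷ st)) (↭-sym (shift x (y ∷ st) inp))
... | no  _ = prep y (run-∷-↭ x inp st)

length-run : ∀ inp st → length (run inp st) ≡ length (st ++ inp)
length-run inp st = ↭-length (run-↭ inp st)

Run-run   : ∀ inp st → Unique (st ++ inp) → AvoidsAll T123-132 st → Run T123-132 inp st (run inp st)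
Run-run-∷ : ∀ x inp st → Unique (st ++ x ∷ inp) → AvoidsAll T123-132 st →
            Run T123-132 (x ∷ inp) st (run-∷ x inp st)
Run-run []        st _ _ = Run-flush st
Run-run (x ∷ inp) st     = Run-run-∷ x inp st
Run-run-∷ x inp [] u avoids = push allowed (Run-run inp [ x ] u allowed)
  where allowed = push-allowed avoids z≤n
Run-run-∷ x inp (y ∷ st) u avoids with countAbove x (y ∷ st) ≤? 1
... | yes count≤1 = push allowed (Run-run inp (x ∷ y ∷ st) (Unique-resp-↭ (shift x (y ∷ st) inp) u) allowed)
  where allowed = push-allowed avoids count≤1
... | no  count≰1 = pop (push-forbidden (proj₁ (Unique-++⁻ (y ∷ st) u)) (≰⇒> count≰1))
                        (Run-run-∷ x inp st (AllPairs.tail u) (AvoidsAll-⊆ (y ∷ʳ ⊆-refl) avoids))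

sMap-sT : ∀ {π} → Unique π → sMap T123-132 π (sT π)
sMap-sT {π} u = Run-run π [] u (Avoids-[] _ _ ∷ Avoids-[] _ _ ∷ [])

sMap⇒≡sT : ∀ {π σ} → Unique π → sMap T123-132 π σ → σ ≡ sT π
sMap⇒≡sT u r = Run-deterministic r (sMap-sT u)

-- Stack dynamics

run-pop-above : ∀ {b inp a} t → All (b <_) (t ++ [ a ]) →
                run (b ∷ inp) (t ++ [ a ]) ≡ t ++ run inp (b ∷ a ∷ [])
run-pop-above {b} {a = a} []      _       = run-push [ a ] (length-filter (b <?_) [ a ])
run-pop-above {b} {a = a} (y ∷ t) b<y∷t∷a =
  trans (run-pop two≤) (cong (y ∷_) (run-pop-above t (All.tail b<y∷t∷a)))
  where
  two≤ : 2 ≤ countAbove b (y ∷ t ++ [ a ])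
  two≤ = subst (2 ≤_) (sym (countAbove-all b<y∷t∷a)) (s≤s (subst (1 ≤_) (sym (length-∷ʳ t a)) (s≤s z≤n)))

-- out and t′ ++ B are the output so far and the stack after reading w.
run-keeps-bottom : ∀ {B} w t → All (λ x → countAbove x B ≤ 1) w →
                   ∃₂ λ out t′ → ∀ v → run (w ++ v) (t ++ B) ≡ out ++ run v (t′ ++ B)
run-keeps-bottom []          t _                = [] , t , λ _ → refl
run-keeps-bottom {B} (x ∷ w) t (fits ∷ all-fit) = push-x t
  where
  push-x : ∀ t → ∃₂ λ out t′ → ∀ v → run (x ∷ w ++ v) (t ++ B) ≡ out ++ run v (t′ ++ B)
  push-x [] with run-keeps-bottom w [ x ] all-fit
  ... | out , t′ , eq = out , t′ , λ v → trans (run-push B fits) (eq v)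
  push-x (y ∷ t) with ≤-<-connex (countAbove x (y ∷ t ++ B)) 1
  ... | inj₁ fits-on-t with run-keeps-bottom w (x ∷ y ∷ t) all-fit
  ...   | out , t′ , eq = out , t′ , λ v → trans (run-push (y ∷ t ++ B) fits-on-t) (eq v)
  push-x (y ∷ t) | inj₂ blocked with push-x t
  ...   | out , t′ , eq = y ∷ out , t′ , λ v → trans (run-pop blocked) (cong (y ∷_) (eq v))

bottom-stays : ∀ {B} w → All (λ x → countAbove x B ≤ 1) w → ∃ λ Y → run w B ≡ Y ++ B
bottom-stays {B} w all-fit with run-keeps-bottom w [] all-fit
... | out , t , eq = out ++ t , (begin
  run w B          ≡⟨ cong (λ u → run u B) (sym (++-identityʳ w)) ⟩
  run (w ++ []) B  ≡⟨ eq [] ⟩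
  out ++ t ++ B    ≡⟨ sym (++-assoc out t B) ⟩
  (out ++ t) ++ B  ∎)

run-over-bottom : ∀ {P : ℕ → Set} a w → All P (a ∷ w) →
                  ∃₂ λ out t → All P (t ++ [ a ]) × run w [ a ] ≡ out ++ t ++ [ a ] ×
                               ∀ v → run (w ++ v) [ a ] ≡ out ++ run v (t ++ [ a ])
run-over-bottom a w P-a∷w with run-keeps-bottom w [] (All.universal (λ x → length-filter (x <?_) [ a ]) w)
... | out , t , eq = out , t , ++⁻ʳ out (subst (All _) run-w P-run-w) , run-w , eq
  where
  run-w : run w [ a ] ≡ out ++ t ++ [ a ]
  run-w = trans (cong (λ u → run u [ a ]) (sym (++-identityʳ w))) (eq [])
  P-run-w : All _ (run w [ a ])
  P-run-w = All-resp-↭ (↭-sym (run-↭ w [ a ])) P-a∷w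

-- Ladders and levels

-- ladder [z₁, …, zⱼ] = [j, z₁, j−1, z₂, …, 1, zⱼ]: a half-decreasing permutation is one
-- that ends in a ladder of length 2⌊(n−1)/2⌋.
ladder : List ℕ → List ℕ
ladder []       = []
ladder (z ∷ zs) = suc (length zs) ∷ z ∷ ladder zs

unfoldLadder : ℕ → List ℕ → List ℕ
unfoldLadder zero    F       = ladder F
unfoldLadder (suc k) []      = []
unfoldLadder (suc k) (x ∷ F) = x ∷ unfoldLadder k F

unfoldLadder-++ : ∀ P zs → unfoldLadder (length P) (P ++ zs) ≡ P ++ ladder zs
unfoldLadder-++ []      zs = refl
unfoldLadder-++ (x ∷ P) zs = cong (x ∷_) (unfoldLadder-++ P zs)

ladder-∷ʳ : ∀ zs a → ladder (zs ++ [ a ]) ≡ suc (length zs) ∷ unfoldLadder 1 (zs ++ [ a ])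
ladder-∷ʳ []       a = refl
ladder-∷ʳ (z ∷ zs) a = cong (λ k → suc k ∷ z ∷ ladder (zs ++ [ a ])) (length-∷ʳ zs a)

length-ladder : ∀ zs → length (ladder zs) ≡ length zs + length zs
length-ladder []       = refl
length-ladder (z ∷ zs) = cong suc (trans (cong suc (length-ladder zs)) (sym (+-suc (length zs) (length zs))))

run-ladder : ∀ zs t a → All (length zs <_) (t ++ [ a ]) → All (length zs <_) zs →
             run (ladder zs) (t ++ [ a ]) ≡ t ++ unfoldLadder 1 (zs ++ [ a ])
run-ladder []       t a _ _ = refl
run-ladder (z ∷ zs) t a j+1<t∷a (j+1<z ∷ j+1<zs) = begin
  run (suc j ∷ z ∷ ladder zs) (t ++ [ a ])        ≡⟨ run-pop-above t j+1<t∷a ⟩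
  t ++ run (z ∷ ladder zs) (suc j ∷ a ∷ [])        ≡⟨ cong (t ++_) (run-push {inp = ladder zs} _ z-fits) ⟩
  t ++ run (ladder zs) ((z ∷ [ suc j ]) ++ [ a ])  ≡⟨ cong (t ++_) (run-ladder zs _ a j<z∷j+1∷a j<zs) ⟩
  t ++ z ∷ suc j ∷ unfoldLadder 1 (zs ++ [ a ])    ≡⟨ cong (λ l → t ++ z ∷ l) (sym (ladder-∷ʳ zs a)) ⟩
  t ++ unfoldLadder 1 ((z ∷ zs) ++ [ a ])          ∎
  where
  j = length zs
  weaken : ∀ {x} → suc j < x → j < x
  weaken = <-trans (n<1+n j)
  z-fits : countAbove z (suc j ∷ [ a ]) ≤ 1
  z-fits = countAbove-pair (<-asym j+1<z)
  j<z∷j+1∷a : All (j <_) ((z ∷ [ suc j ]) ++ [ a ])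
  j<z∷j+1∷a = weaken j+1<z ∷ n<1+n j ∷ All.map weaken (++⁻ʳ t j+1<t∷a)
  j<zs : All (j <_) zs
  j<zs = All.map weaken j+1<zs

sT-ladder : ∀ a w zs → All (length zs <_) (a ∷ w ++ zs) →
            ∃ λ X → run w [ a ] ≡ X ++ [ a ] ×
                    sT ((a ∷ w) ++ ladder zs) ≡ X ++ unfoldLadder 1 (zs ++ [ a ])
sT-ladder a w zs above with ++⁻ (a ∷ w) above
... | above-a∷w , above-zs with run-over-bottom a w above-a∷w
...   | out , t , above-t∷a , run-w , run-w++ = out ++ t , trans run-w (sym (++-assoc out t [ a ])) , (begin
  run (w ++ ladder zs) [ a ]                 ≡⟨ run-w++ (ladder zs) ⟩
  out ++ run (ladder zs) (t ++ [ a ])        ≡⟨ cong (out ++_) (run-ladder zs t a above-t∷a above-zs) ⟩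
  out ++ t ++ unfoldLadder 1 (zs ++ [ a ])   ≡⟨ sym (++-assoc out t _) ⟩
  (out ++ t) ++ unfoldLadder 1 (zs ++ [ a ]) ∎)

run-lifts-bottom : ∀ {b} a u v → All (b <_) (a ∷ u) → All (b <_) v →
                   ∃ λ Y → run (u ++ b ∷ v) [ a ] ≡ Y ++ b ∷ a ∷ []
run-lifts-bottom {b} a u v b<a∷u b<v with run-over-bottom a u b<a∷u
                                        | bottom-stays {b ∷ [ a ]} v (All.map (countAbove-pair ∘ <-asym) b<v)
... | out , t , b<t∷a , _ , run-u++ | Y , run-v = out ++ t ++ Y , (begin
  run (u ++ b ∷ v) [ a ]           ≡⟨ run-u++ (b ∷ v) ⟩
  out ++ run (b ∷ v) (t ++ [ a ])  ≡⟨ cong (out ++_) (run-pop-above t b<t∷a) ⟩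
  out ++ t ++ run v (b ∷ [ a ])    ≡⟨ cong (λ l → out ++ t ++ l) run-v ⟩
  out ++ t ++ Y ++ b ∷ [ a ]       ≡⟨ cong (out ++_) (sym (++-assoc t Y _)) ⟩
  out ++ (t ++ Y) ++ b ∷ [ a ]     ≡⟨ sym (++-assoc out (t ++ Y) _) ⟩
  (out ++ t ++ Y) ++ b ∷ [ a ]     ∎)

IsPerm-Unique : ∀ {n ρ} → IsPerm n ρ → Unique ρ
IsPerm-Unique {n} p = Unique-resp-↭ (↭-sym p) (Unique.map⁺ suc-injective (Unique.upTo⁺ n))

IsPerm-positive : ∀ {n ρ x} → IsPerm n ρ → x ∈ ρ → 1 ≤ x
IsPerm-positive p x∈ρ with ∈-map⁻ suc (∈-resp-↭ p x∈ρ)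
... | _ , _ , refl = s≤s z≤n

IsPerm-∈ : ∀ {n ρ k} → IsPerm n ρ → 1 ≤ k → k ≤ n → k ∈ ρ
IsPerm-∈ p (s≤s z≤n) k≤n = ∈-resp-↭ (↭-sym p) (∈-map⁺ suc (∈-upTo⁺ k≤n))

IsPerm-length : ∀ {n ρ} → IsPerm n ρ → length ρ ≡ n
IsPerm-length {n} p = trans (↭-length p) (trans (length-map suc (upTo n)) (length-upTo n))

sT-IsPerm : ∀ {n ρ} → IsPerm n ρ → IsPerm n (sT ρ)
sT-IsPerm {ρ = ρ} = ↭-trans (run-↭ ρ [])

^-IsPerm : ∀ {n ρ} → IsPerm n ρ → ∀ k → IsPerm n ((sT ^ k) ρ)
^-IsPerm p zero    = p
^-IsPerm p (suc k) = ^-IsPerm (sT-IsPerm p) k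

ladder-↭ : ∀ zs → ladder zs ↭ zs ++ map suc (downFrom (length zs))
ladder-↭ []       = refl
ladder-↭ (z ∷ zs) = ↭-trans (swap _ z (ladder-↭ zs)) (prep z (↭-sym (shift (suc (length zs)) zs _)))

∈-ladder-labels⁺ : ∀ {j k} → 1 ≤ k → k ≤ j → k ∈ map suc (downFrom j)
∈-ladder-labels⁺ (s≤s z≤n) k≤j = ∈-map⁺ suc (∈-downFrom⁺ k≤j)

∈-ladder-labels⁻ : ∀ {j k} → k ∈ map suc (downFrom j) → k ≤ j
∈-ladder-labels⁻ k∈ with ∈-map⁻ suc k∈
... | _ , i∈ , refl = ∈-downFrom⁻ i∈

Level : ℕ → List ℕ → Set
Level j ρ = ∃₂ λ P zs → ρ ≡ P ++ ladder zs × length zs ≡ j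

Level-cong : ∀ {j k ρ} → j ≡ k → Level j ρ → Level k ρ
Level-cong refl level = level

Level-zero : ∀ ρ → Level 0 ρ
Level-zero ρ = ρ , [] , sym (++-identityʳ ρ) , refl

Level-++ˡ : ∀ X {j ρ} → Level j ρ → Level j (X ++ ρ)
Level-++ˡ X (P , zs , refl , len) = X ++ P , zs , sym (++-assoc X P (ladder zs)) , len

Level-unfoldLadder : ∀ k F → Level (length F ∸ k) (unfoldLadder k F)
Level-unfoldLadder zero    F       = [] , F , refl , refl
Level-unfoldLadder (suc k) []      = Level-zero []
Level-unfoldLadder (suc k) (x ∷ F) = Level-++ˡ [ x ] (Level-unfoldLadder k F)

Level-length : ∀ {n} P zs → IsPerm n (P ++ ladder zs) → length P + (length zs + length zs) ≡ n
Level-length P zs p =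
  trans (cong (length P +_) (sym (length-ladder zs))) (trans (sym (length-++ P)) (IsPerm-length p))

ladder-rearranged : ∀ P zs → P ++ ladder zs ↭ (P ++ zs) ++ map suc (downFrom (length zs))
ladder-rearranged P zs = ↭-trans (++⁺ˡ P (ladder-↭ zs)) (↭-reflexive (sym (++-assoc P zs _)))

∈-Level⁻ : ∀ {x} P zs → x ∈ P ++ ladder zs → x ∈ P ++ zs ⊎ x ≤ length zs
∈-Level⁻ P zs x∈ with ∈-++⁻ (P ++ zs) (∈-resp-↭ (ladder-rearranged P zs) x∈)
... | inj₁ x∈P++zs   = inj₁ x∈P++zs
... | inj₂ x∈labels = inj₂ (∈-ladder-labels⁻ x∈labels)

-- 1, …, j already occur as labels of the ladder, so every other entry exceeds j.
Level-above : ∀ {n} P zs → IsPerm n (P ++ ladder zs) → All (length zs <_) (P ++ zs)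
Level-above P zs p = All.tabulate λ x∈ → ≰⇒> λ x≤j →
  disjoint (x∈ , ∈-ladder-labels⁺ (IsPerm-positive p (∈-resp-↭ (↭-sym rearranged) (∈-++⁺ˡ x∈))) x≤j)
  where
  rearranged = ladder-rearranged P zs
  disjoint = proj₂ (proj₂ (Unique-++⁻ (P ++ zs) (Unique-resp-↭ rearranged (IsPerm-Unique p))))

sT-preserves-Level : ∀ {n j ρ} → IsPerm n ρ → j + j < n → Level j ρ → Level j (sT ρ)
sT-preserves-Level p 2j<n ([] , zs , refl , refl) = ⊥-elim (<-irrefl (Level-length [] zs p) 2j<n)
sT-preserves-Level p _ (a ∷ w , zs , refl , refl) with sT-ladder a w zs (Level-above (a ∷ w) zs p)
... | X , _ , eq = subst (Level (length zs)) (sym eq) (Level-++ˡ X level)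
  where
  level : Level (length zs) (unfoldLadder 1 (zs ++ [ a ]))
  level = Level-cong (cong (_∸ 1) (length-∷ʳ zs a)) (Level-unfoldLadder 1 (zs ++ [ a ]))

Level-stable : ∀ {n j ρ} → IsPerm n ρ → j + j < n → Level j ρ → ∀ k → Level j ((sT ^ k) ρ)
Level-stable p 2j<n level zero    = level
Level-stable p 2j<n level (suc k) = Level-stable (sT-IsPerm p) 2j<n (sT-preserves-Level p 2j<n level) k

next-above : ∀ {j x} → j < x → x ≢ suc j → suc j < x
next-above j<x x≢j+1 = ≤∧≢⇒< j<x (x≢j+1 ∘ sym)

next-label-least : ∀ {n} a u b v zs → IsPerm n ((a ∷ u ++ b ∷ v) ++ ladder zs) → b ≡ suc (length zs) →
                   All (b <_) (a ∷ u) × All (b <_) v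
next-label-least a u b v zs p refl
  with ++⁻ (a ∷ u ++ b ∷ v) (Level-above (a ∷ u ++ b ∷ v) zs p)
     | proj₁ (Unique-++⁻ (a ∷ u ++ b ∷ v) (IsPerm-Unique p))
... | j<a ∷ j<u++b∷v , _ | a∉ ∷ unique-u++b∷v
  with ++⁻ u j<u++b∷v | Unique-++⁻ u unique-u++b∷v
...   | j<u , _ ∷ j<v | _ , b∉v ∷ _ , u#b∷v =
  next-above j<a (All.lookup (++⁻ʳ u a∉) (here refl))
    ∷ All.tabulate (λ {x} x∈u → next-above (All.lookup j<u x∈u) λ x≡b → u#b∷v (x∈u , here x≡b)) ,
  All.tabulate λ {x} x∈v → next-above (All.lookup j<v x∈v) λ x≡b → All.lookup b∉v x∈v (sym x≡b)

sT-enters-next-Level : ∀ {n} a u b v zs → IsPerm n ((a ∷ u ++ b ∷ v) ++ ladder zs) → b ≡ suc (length zs) →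
                       Level (suc (length zs)) (sT ((a ∷ u ++ b ∷ v) ++ ladder zs))
sT-enters-next-Level a u b v zs p b≡j+1
  with next-label-least a u b v zs p b≡j+1
... | b<a∷u , b<v
  with run-lifts-bottom a u v b<a∷u b<v | sT-ladder a (u ++ b ∷ v) zs (Level-above (a ∷ u ++ b ∷ v) zs p)
...   | Y , run-lifted | X , run-w , sT-ρ = Y , zs ++ [ a ] , (begin
  sT ((a ∷ u ++ b ∷ v) ++ ladder zs)           ≡⟨ sT-ρ ⟩
  X ++ unfoldLadder 1 (zs ++ [ a ])             ≡⟨ cong (_++ _) X≡Y∷ʳb ⟩
  (Y ++ [ b ]) ++ unfoldLadder 1 (zs ++ [ a ])  ≡⟨ ++-assoc Y [ b ] _ ⟩
  Y ++ b ∷ unfoldLadder 1 (zs ++ [ a ])         ≡⟨ cong (λ c → Y ++ c ∷ _) b≡j+1 ⟩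
  Y ++ suc (length zs) ∷ unfoldLadder 1 (zs ++ [ a ]) ≡⟨ cong (Y ++_) (sym (ladder-∷ʳ zs a)) ⟩
  Y ++ ladder (zs ++ [ a ])                     ∎) , length-∷ʳ zs a
  where
  X≡Y∷ʳb : X ≡ Y ++ [ b ]
  X≡Y∷ʳb = ∷ʳ-injectiveˡ X (Y ++ [ b ]) (trans (sym run-w) (trans run-lifted (sym (++-assoc Y _ _))))

sT-shifts-ladder : ∀ {n a w zs h t} → IsPerm n ((a ∷ w) ++ ladder zs) → 1 ≤ length w →
                   zs ++ [ a ] ≡ h ∷ t →
                   ∃₂ λ x X → sT ((a ∷ w) ++ ladder zs) ≡ (x ∷ X ++ [ h ]) ++ ladder t
sT-shifts-ladder {a = a} {w} {zs} {h} {t} p 1≤|w| split with sT-ladder a w zs (Level-above (a ∷ w) zs p)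
... | [] , run-w , _ = ⊥-elim (1+n≰n (subst (1 ≤_) |w|≡0 1≤|w|))
  where
  |w|≡0 : length w ≡ 0
  |w|≡0 = suc-injective (trans (sym (length-run w [ a ])) (cong length run-w))
... | x ∷ X , _ , sT-ρ = x , X , (begin
  sT ((a ∷ w) ++ ladder zs)                ≡⟨ sT-ρ ⟩
  (x ∷ X) ++ unfoldLadder 1 (zs ++ [ a ])  ≡⟨ cong (λ F → (x ∷ X) ++ unfoldLadder 1 F) split ⟩
  (x ∷ X) ++ h ∷ ladder t                  ≡⟨ sym (++-assoc (x ∷ X) [ h ] (ladder t)) ⟩
  (x ∷ X ++ [ h ]) ++ ladder t             ∎)

length-split : ∀ {zs a h t} → zs ++ [ a ] ≡ h ∷ t → length t ≡ length zs
length-split {zs} {a} split = suc-injective (trans (sym (cong length split)) (length-∷ʳ zs a))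

sT-reaches-next-Level : ∀ {n} u {a w zs v} → IsPerm n ((a ∷ w) ++ ladder zs) → 1 ≤ length w →
                        zs ++ [ a ] ≡ u ++ suc (length zs) ∷ v →
                        Level (suc (length zs)) ((sT ^ (2 + length u)) ((a ∷ w) ++ ladder zs))
sT-reaches-next-Level [] {zs = zs} {v} p 1≤|w| split with sT-shifts-ladder p 1≤|w| split
... | x , X , sT-ρ =
  subst (λ ρ → Level _ (sT ρ)) (sym sT-ρ)
    (Level-cong (cong suc (length-split split))
      (sT-enters-next-Level x X _ [] v (subst (IsPerm _) sT-ρ (sT-IsPerm p))
        (cong suc (sym (length-split split)))))
sT-reaches-next-Level (e ∷ u) {zs = zs} {v} p 1≤|w| split with sT-shifts-ladder p 1≤|w| split
... | x , X , sT-ρ =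
  subst (λ ρ → Level _ ((sT ^ (2 + length u)) ρ)) (sym sT-ρ)
    (Level-cong (cong suc (length-split split))
      (sT-reaches-next-Level u (subst (IsPerm _) sT-ρ (sT-IsPerm p))
        (subst (1 ≤_) (sym (length-∷ʳ X e)) (s≤s z≤n)) split′))
  where
  split′ : (u ++ suc (length zs) ∷ v) ++ [ x ] ≡ u ++ suc (length (u ++ suc (length zs) ∷ v)) ∷ v ++ [ x ]
  split′ = trans (++-assoc u _ [ x ]) (cong (λ k → u ++ suc k ∷ v ++ [ x ]) (sym (length-split split)))

locate-next-label : ∀ {n} a w zs → IsPerm n ((a ∷ w) ++ ladder zs) → suc (length zs) ≤ n →
                    (∃₂ λ u v → w ≡ u ++ suc (length zs) ∷ v) ⊎
                    (∃₂ λ u v → zs ++ [ a ] ≡ u ++ suc (length zs) ∷ v)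
locate-next-label a w zs p j+1≤n with ∈-Level⁻ (a ∷ w) zs (IsPerm-∈ p (s≤s z≤n) j+1≤n)
... | inj₂ j+1≤j              = ⊥-elim (1+n≰n j+1≤j)
... | inj₁ (here j+1≡a)       = inj₂ (∈-∃++ (∈-++⁺ʳ zs (here j+1≡a)))
... | inj₁ (there j+1∈w++zs) with ∈-++⁻ w j+1∈w++zs
...   | inj₁ j+1∈w  = inj₁ (∈-∃++ j+1∈w)
...   | inj₂ j+1∈zs = inj₂ (∈-∃++ (∈-++⁺ˡ j+1∈zs))

Level-prefix-long : ∀ {n} P zs → IsPerm n (P ++ ladder zs) → suc (length zs) + suc (length zs) < n →
                    2 < length P
Level-prefix-long P zs p lt =
  +-cancelʳ-< (j + j) 2 (length P) (subst₂ _<_ (cong suc (+-suc j j)) (sym (Level-length P zs p)) lt)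
  where j = length zs

Level-progress : ∀ {n j ρ} → IsPerm n ρ → suc j + suc j < n → Level j ρ →
                 ∃ λ k → Level (suc j) ((sT ^ k) ρ)
Level-progress p lt ([] , zs , refl , refl) with Level-prefix-long [] zs p lt
... | ()
Level-progress p lt (a ∷ w , zs , refl , refl) with locate-next-label a w zs p (≤-trans (m≤m+n _ _) (<⇒≤ lt))
... | inj₁ (u , v , refl)  = 1 , sT-enters-next-Level a u _ v zs p refl
... | inj₂ (u , v , split) = 2 + length u , sT-reaches-next-Level u p 1≤|w| split
  where 1≤|w| = ≤-trans (s≤s z≤n) (≤-pred (Level-prefix-long (a ∷ w) zs p lt))

Level-eventually : ∀ {n} j {ρ} → IsPerm n ρ → j + j < n → ∃ λ K → Level j ((sT ^ K) ρ)
Level-eventually zero    {ρ} _ _  = 0 , Level-zero ρ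
Level-eventually (suc j) {ρ} p lt with Level-eventually j p (<-trans (+-mono-< (n<1+n j) (n<1+n j)) lt)
... | K , level with Level-progress (^-IsPerm p K) lt level
...   | k , level′ = K + k , subst (Level (suc j)) (sym (^-+ sT K k ρ)) level′

TransClosure-sMap⇒^ : ∀ {n ρ σ} → IsPerm n ρ → TransClosure (sMap T123-132) ρ σ →
                      ∃ λ k → (sT ^ suc k) ρ ≡ σ
TransClosure-sMap⇒^ p [ step ]⁺ = 0 , sym (sMap⇒≡sT (IsPerm-Unique p) step)
TransClosure-sMap⇒^ p (step ∷ steps) with sMap⇒≡sT (IsPerm-Unique p) step
... | refl with TransClosure-sMap⇒^ (sT-IsPerm p) steps
...   | k , eq = suc k , eq

^⇒TransClosure-sMap : ∀ {n ρ} → IsPerm n ρ → ∀ k → TransClosure (sMap T123-132) ρ ((sT ^ suc k) ρ)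
^⇒TransClosure-sMap p zero    = [ sMap-sT (IsPerm-Unique p) ]⁺
^⇒TransClosure-sMap p (suc k) = sMap-sT (IsPerm-Unique p) ∷ ^⇒TransClosure-sMap (sT-IsPerm p) k

-- A periodic π returns to itself after K·(q+1) steps, and by then it has reached level j.
Periodic⇒Level : ∀ {n j π} → IsPerm n π → Periodic T123-132 π → j + j < n → Level j π
Periodic⇒Level {j = j} {π} p periodic lt with TransClosure-sMap⇒^ p periodic | Level-eventually j p lt
... | q , period | K , level = subst (Level j) returns (Level-stable (^-IsPerm p K) lt level (K * q))
  where
  returns : (sT ^ (K * q)) ((sT ^ K) π) ≡ π
  returns = begin
    (sT ^ (K * q)) ((sT ^ K) π)  ≡⟨ sym (^-+ sT K (K * q) π) ⟩
    (sT ^ (K + K * q)) π         ≡⟨ cong (λ e → (sT ^ e) π) (sym (*-suc K q)) ⟩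
    (sT ^ (K * suc q)) π         ≡⟨ ^-*-periodic sT q period K ⟩
    π                            ∎

-- Half-decreasing permutations

halving : ∀ n → 1 ≤ n → ∃ λ r → r ≤ 1 × n ≡ suc r + ((n ∸ 1) / 2 + (n ∸ 1) / 2)
halving (suc n) _ =
  n % 2 , ≤-pred (m%n<n n 2) , cong suc (trans (m≡m%n+[m/n]*n n 2) (cong (n % 2 +_) (double (n / 2))))
  where
  double : ∀ q → q * 2 ≡ q + q
  double q = trans (*-comm q 2) (cong (q +_) (+-identityʳ q))

at-++ : ∀ P L k → at (P ++ L) (length P + suc k) ≡ at L (suc k)
at-++ []      L k = refl
at-++ (x ∷ P) L k = begin
  at (x ∷ P ++ L) (suc (length P + suc k))  ≡⟨ cong (λ i → at (x ∷ P ++ L) (suc i)) (+-suc (length P) k) ⟩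
  at (P ++ L) (suc (length P + k))          ≡⟨ cong (at (P ++ L)) (sym (+-suc (length P) k)) ⟩
  at (P ++ L) (length P + suc k)            ≡⟨ at-++ P L k ⟩
  at L (suc k)                              ∎

position-identity : ∀ p d i → suc (p + ((i + d) + (i + d))) ≡ p + suc (2 * d) + 2 * i
position-identity = solve-∀

at-++-ladder-position : ∀ P L {n m i} → n ≡ length P + (m + m) → i ≤ m →
                        at (P ++ L) (suc n ∸ 2 * i) ≡ at L (suc (2 * (m ∸ i)))
at-++-ladder-position P L {n} {m} {i} refl i≤m = begin
  at (P ++ L) (suc (length P + (m + m)) ∸ 2 * i)        ≡⟨ cong (λ k → at (P ++ L) (k ∸ 2 * i)) position ⟩
  at (P ++ L) (length P + suc (2 * d) + 2 * i ∸ 2 * i)  ≡⟨ cong (at (P ++ L)) (m+n∸n≡m _ (2 * i)) ⟩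
  at (P ++ L) (length P + suc (2 * d))                  ≡⟨ at-++ P L (2 * d) ⟩
  at L (suc (2 * d))                                    ∎
  where
  d = m ∸ i
  position : suc (length P + (m + m)) ≡ length P + suc (2 * d) + 2 * i
  position = trans (cong (λ e → suc (length P + (e + e))) (sym (m+[n∸m]≡n i≤m)))
                   (position-identity (length P) d i)

odd-position-suc : ∀ {m i} → i ≤ m → suc (2 * (suc m ∸ i)) ≡ suc (suc (suc (2 * (m ∸ i))))
odd-position-suc {m} {i} i≤m =
  trans (cong (λ d → suc (2 * d)) (+-∸-assoc 1 i≤m)) (cong suc (*-suc 2 (m ∸ i)))

LadderLabels : ℕ → List ℕ → Set
LadderLabels m L = ∀ i → 1 ≤ i → i ≤ m → at L (suc (2 * (m ∸ i))) ≡ just i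

at-ladder : ∀ zs → LadderLabels (length zs) (ladder zs)
at-ladder []       i (s≤s z≤n) ()
at-ladder (z ∷ zs) i 1≤i i≤j+1 with i ≟ suc (length zs)
... | yes refl = cong (λ d → at (ladder (z ∷ zs)) (suc (2 * d))) (n∸n≡0 (length zs))
... | no  i≢j+1 = trans (cong (at (ladder (z ∷ zs))) (odd-position-suc i≤j)) (at-ladder zs i 1≤i i≤j)
  where i≤j = ≤-pred (≤∧≢⇒< i≤j+1 i≢j+1)

LadderLabels⇒ladder : ∀ m L → length L ≡ m + m → LadderLabels m L →
                      ∃ λ zs → L ≡ ladder zs × length zs ≡ m
LadderLabels⇒ladder zero    []          _   _        = [] , refl , refl
LadderLabels⇒ladder zero    (_ ∷ _)     ()  _
LadderLabels⇒ladder (suc m) []          ()  _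
LadderLabels⇒ladder (suc m) (_ ∷ [])    len _        =
  ⊥-elim (0≢1+n (trans (suc-injective len) (+-suc m m)))
LadderLabels⇒ladder (suc m) (x ∷ y ∷ L) len labelled =
  y ∷ zs , cong₂ (λ k l → k ∷ y ∷ l) (trans x≡m+1 (cong suc (sym |zs|≡m))) L≡ , cong suc |zs|≡m
  where
  labelled′ : LadderLabels m L
  labelled′ i 1≤i i≤m =
    trans (cong (at (x ∷ y ∷ L)) (sym (odd-position-suc i≤m))) (labelled i 1≤i (m≤n⇒m≤1+n i≤m))
  rest = LadderLabels⇒ladder m L (suc-injective (trans (suc-injective len) (+-suc m m))) labelled′
  zs = proj₁ rest
  L≡ = proj₁ (proj₂ rest)
  |zs|≡m = proj₂ (proj₂ rest)
  x≡m+1 : x ≡ suc m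
  x≡m+1 = just-injective (trans (cong (λ d → at (x ∷ y ∷ L) (suc (2 * d))) (sym (n∸n≡0 m)))
                                (labelled (suc m) (s≤s z≤n) ≤-refl))

Level⇒half-decreasing : ∀ {n m π} → IsPerm n π → Level m π →
                        ∀ i → 1 ≤ i → i ≤ m → at π (suc n ∸ 2 * i) ≡ just i
Level⇒half-decreasing p (P , zs , refl , refl) i 1≤i i≤m =
  trans (at-++-ladder-position P (ladder zs) (sym (Level-length P zs p)) i≤m) (at-ladder zs i 1≤i i≤m)

half-decreasing⇒ladder-suffix : ∀ {n π} r m → n ≡ suc r + (m + m) → IsPerm n π →
                                (∀ i → 1 ≤ i → i ≤ m → at π (suc n ∸ 2 * i) ≡ just i) →
                                ∃₂ λ P zs → π ≡ P ++ ladder zs × length P ≡ suc r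
half-decreasing⇒ladder-suffix {n} {π} r m n≡ p labelled with split-at (suc r) π prefix-fits
  where
  prefix-fits : suc r ≤ length π
  prefix-fits = subst (suc r ≤_) (sym (trans (IsPerm-length p) n≡)) (m≤m+n (suc r) (m + m))
... | P , L , refl , |P|≡r+1 with LadderLabels⇒ladder m L |L|≡2m labelled-L
  where
  n≡|P|+2m : n ≡ length P + (m + m)
  n≡|P|+2m = trans n≡ (cong (_+ (m + m)) (sym |P|≡r+1))
  |L|≡2m : length L ≡ m + m
  |L|≡2m = +-cancelˡ-≡ (length P) _ _ (trans (sym (length-++ P)) (trans (IsPerm-length p) n≡|P|+2m))
  labelled-L : LadderLabels m L
  labelled-L i 1≤i i≤m = trans (sym (at-++-ladder-position P L n≡|P|+2m i≤m)) (labelled i 1≤i i≤m)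
...   | zs , refl , _ = P , zs , refl , |P|≡r+1

-- Rotation at the top level

rotate : List ℕ → List ℕ
rotate []       = []
rotate (x ∷ xs) = xs ++ [ x ]

rotate-^-++ : ∀ u v → (rotate ^ length u) (u ++ v) ≡ v ++ u
rotate-^-++ []      v = sym (++-identityʳ v)
rotate-^-++ (x ∷ u) v = begin
  (rotate ^ length u) ((u ++ v) ++ [ x ])  ≡⟨ cong (rotate ^ length u) (++-assoc u v [ x ]) ⟩
  (rotate ^ length u) (u ++ v ++ [ x ])    ≡⟨ rotate-^-++ u (v ++ [ x ]) ⟩
  (v ++ [ x ]) ++ u                        ≡⟨ ++-assoc v [ x ] u ⟩
  v ++ x ∷ u                               ∎

rotate-^-length : ∀ F → (rotate ^ length F) F ≡ F
rotate-^-length F = trans (cong (rotate ^ length F) (sym (++-identityʳ F))) (rotate-^-++ F [])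

sT-rotates : ∀ {n} k F → k ≤ 1 → IsPerm n (unfoldLadder (suc k) F) →
             sT (unfoldLadder (suc k) F) ≡ unfoldLadder (suc k) (rotate F)
sT-rotates k             []           _        _ = refl
sT-rotates zero          (a ∷ zs)     _        p with sT-ladder a [] zs (Level-above [ a ] zs p)
... | X , run-w , sT-ρ = trans sT-ρ (cong (_++ _) (sym (∷ʳ-injectiveˡ [] X run-w)))
sT-rotates (suc zero)    (a ∷ [])     _        _ = refl
sT-rotates (suc zero)    (a ∷ b ∷ zs) _        p with sT-ladder a [ b ] zs (Level-above (a ∷ [ b ]) zs p)
... | X , run-w , sT-ρ =
  trans sT-ρ (cong (_++ _) (∷ʳ-injectiveˡ X [ b ] (trans (sym run-w) run-b)))
  where
  run-b : run [ b ] [ a ] ≡ b ∷ [ a ]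
  run-b = run-push [ a ] (length-filter (b <?_) [ a ])
sT-rotates (suc (suc k)) _            (s≤s ()) _

sT-^-rotates : ∀ {n} k → k ≤ 1 → ∀ m F → IsPerm n (unfoldLadder (suc k) F) →
               (sT ^ m) (unfoldLadder (suc k) F) ≡ unfoldLadder (suc k) ((rotate ^ m) F)
sT-^-rotates k k≤1 zero    F p = refl
sT-^-rotates k k≤1 (suc m) F p = trans (cong (sT ^ m) (sT-rotates k F k≤1 p))
  (sT-^-rotates k k≤1 m (rotate F) (subst (IsPerm _) (sT-rotates k F k≤1 p) (sT-IsPerm p)))

short-prefix⇒Periodic : ∀ {n} k P zs → k ≤ 1 → length P ≡ suc k → IsPerm n (P ++ ladder zs) →
                        Periodic T123-132 (P ++ ladder zs)
short-prefix⇒Periodic {n} k (a ∷ w) zs k≤1 refl p =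
  subst (TransClosure (sMap T123-132) π) returns (^⇒TransClosure-sMap p (length (w ++ zs)))
  where
  π = (a ∷ w) ++ ladder zs
  F = (a ∷ w) ++ zs
  π≡ : unfoldLadder (suc k) F ≡ π
  π≡ = unfoldLadder-++ (a ∷ w) zs
  p′ : IsPerm n (unfoldLadder (suc k) F)
  p′ = subst (IsPerm n) (sym π≡) p
  returns : (sT ^ length F) π ≡ π
  returns = begin
    (sT ^ length F) π                             ≡⟨ cong (sT ^ length F) (sym π≡) ⟩
    (sT ^ length F) (unfoldLadder (suc k) F)      ≡⟨ sT-^-rotates k k≤1 (length F) F p′ ⟩
    unfoldLadder (suc k) ((rotate ^ length F) F)  ≡⟨ cong (unfoldLadder (suc k)) (rotate-^-length F) ⟩
    unfoldLadder (suc k) F                        ≡⟨ π≡ ⟩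
    π                                             ∎

theorem4p1 : (n : ℕ) → 1 ≤ n → (π : List ℕ) → IsPerm n π →
    (Periodic T123-132 π ⇔ HalfDecreasing n π)
theorem4p1 n 1≤n π p with halving n 1≤n
... | r , r≤1 , n≡ = mk⇔ periodic⇒half-decreasing half-decreasing⇒periodic
  where
  m = (n ∸ 1) / 2
  m+m<n : m + m < n
  m+m<n = subst (m + m <_) (sym n≡) (s≤s (m≤n+m (m + m) r))
  periodic⇒half-decreasing : Periodic T123-132 π → HalfDecreasing n π
  periodic⇒half-decreasing periodic = Level⇒half-decreasing p (Periodic⇒Level p periodic m+m<n)
  half-decreasing⇒periodic : HalfDecreasing n π → Periodic T123-132 π
  half-decreasing⇒periodic half-decreasing with half-decreasing⇒ladder-suffix r m n≡ p half-decreasing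
  ... | P , zs , refl , |P|≡r+1 = short-prefix⇒Periodic r P zs r≤1 |P|≡r+1 p
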